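{- Let $\Pi$ be the map on $\mathbb{N}=\{1,2,3,\dots\}$ produced by the following procedure. At step $1$ set $\Pi(1)=1$. For $m=2,3,4,\dots$ in turn, at step $m$: if $\Pi(m-\lfloor m/2\rfloor)$ has not been assigned at an earlier step, set $\Pi(m-\lfloor m/2\rfloor)=m$; otherwise set $\Pi(m+\lfloor m/2\rfloor)=m$. Let $n,k\ge 1$ be natural numbers. Then: (a) $\Pi(n)$ never has type (II); (b) if $n=3k$ then $\Pi(n)$ has type (IV); (c) if $n=3k+2$ then $\Pi(n)$ has type (I); (d) if $n=3k+1$ then $\Pi(n)$ has type (I) if $\Pi(k+1)$ has type (I), and $\Pi(n)$ has type (III) if $\Pi(k+1)$ has type (III) or type (IV).
   Context: The procedure assigns a value $\Pi(n)$ to every $n\in\mathbb{N}$. Types: $\Pi(n)$ has type (I) if $\Pi(n)>n$ and $\Pi(n)=2n-1$; type (II) if $\Pi(n)>n$ and $\Pi(n)=2n$; type (III) if $\Pi(n)<n$ and $\Pi(n)=(2n+1)/3$; type (IV) if $\Pi(n)<n$ and $\Pi(n)=2n/3$. -}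

module Defs where

open import Data.Nat using (ℕ; zero; suc; _+_; _*_; _∸_; _<_; _≡ᵇ_; _/_)
open import Data.Bool using (Bool; true; false; if_then_else_; _∨_)
open import Data.Product using (_×_)
open import Relation.Binary.PropositionalEquality using (_≡_)

-- Mutually defined: the state of the procedure and the position filled at each step.
--   filled m p = true  iff  Π(p) has been assigned during steps 1..m
--   pos m      = the argument p for which step m sets Π(p) = m   (m ≥ 1)
-- Step m: c = m - ⌊m/2⌋; if Π(c) unassigned after steps 1..m-1 then set Π(c) = m,
-- otherwise set Π(m + ⌊m/2⌋) = m.  (For m = 1 this gives c = 1, unassigned, so Π(1) = 1.)
mutual
  filled : ℕ → ℕ → Bool
  filled zero    p = false
  filled (suc m) p = filled m p ∨ (p ≡ᵇ pos (suc m))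

  pos : ℕ → ℕ
  pos zero    = zero
  pos (suc m) =
    if filled m (suc m ∸ suc m / 2)
    then suc m + suc m / 2
    else suc m ∸ suc m / 2

lastStep : ℕ → ℕ → ℕ
lastStep n zero    = zero
lastStep n (suc m) = if pos (suc m) ≡ᵇ n then suc m else lastStep n m

-- Step m only ever writes at a position
-- ≥ m - ⌊m/2⌋ = ⌈m/2⌉, so only steps m ≤ 2n can write at n; we take the
-- last such step (the value of Π(n) at the end of the procedure).
Π : ℕ → ℕ
Π n = lastStep n (2 * n)

TypeI : ℕ → Set
TypeI n = (n < Π n) × (Π n ≡ 2 * n ∸ 1)

TypeII : ℕ → Set
TypeII n = (n < Π n) × (Π n ≡ 2 * n)

-- Π(n) = (2n+1)/3, stated without division as 3·Π(n) = 2n+1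
TypeIII : ℕ → Set
TypeIII n = (Π n < n) × (3 * Π n ≡ 2 * n + 1)

-- Π(n) = 2n/3, stated as 3·Π(n) = 2n
TypeIV : ℕ → Set
TypeIV n = (Π n < n) × (3 * Π n ≡ 2 * n)

module Submission where

-- Step m of the procedure looks at the midpoint ⌈m/2⌉: step 2i+1
-- writes position i+1 if it is still free and bounces to 3i+1 otherwise, and
-- step 2i+2 always writes 3i+3 (after step 2i+1 the midpoint i+1 is taken).
-- From this classification of steps ('Action') we show that no position is
-- written twice, so Π(n) is simply the unique step that writes n.  Reading
-- positions modulo 3 then determines their writers:
--   * 3k is written only by the even step 2k, so Π(3k) = 2k         (type IV);
--   * 3k+2 is written only by step 6k+3, which therefore finds it
--     free, so Π(3k+2) = 2(3k+2)−1                                   (type I);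
--   * 3k+1 is written by step 2k+1 if the midpoint k+1 is taken then
--     (type III; and then Π(k+1) ≤ 2k is not of type I), and otherwise
--     by step 6k+1 (type I; and then Π(k+1) = 2k+1 is of type I).
-- Type II would mean that step 2n writes n, but it writes 3n.

open import Defs
open import Data.Nat
open import Data.Nat.Properties
open import Data.Nat.DivMod using (_%_; [m+kn]%n≡m%n; m*n/n≡m; /-congˡ; +-distrib-/-∣ʳ)
open import Data.Nat.Divisibility using (divides-refl)
open import Data.Nat.Tactic.RingSolver using (solve-∀)
open import Data.Bool using (true; false; T; if_then_else_; _∨_)
open import Data.Bool.Properties using (T-≡; ∨-zeroʳ)
open import Data.Product using (Σ; _×_; _,_; proj₁)
open import Data.Sum using (_⊎_; inj₁; inj₂; [_,_]′)
open import Data.Empty using (⊥; ⊥-elim)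
open import Function.Bundles using (Equivalence)
open import Relation.Nullary using (¬_; contradiction)
open import Relation.Binary.PropositionalEquality

open ≡-Reasoning

half-odd : ∀ i → suc (2 * i) / 2 ≡ i
half-odd i = begin
  suc (2 * i) / 2  ≡⟨ /-congˡ {o = 2} (cong suc (*-comm 2 i)) ⟩
  (1 + i * 2) / 2  ≡⟨ +-distrib-/-∣ʳ 1 {d = 2} (divides-refl i) ⟩
  i * 2 / 2        ≡⟨ m*n/n≡m i 2 ⟩
  i                ∎

half-even : ∀ i → suc (suc (2 * i)) / 2 ≡ suc i
half-even i = begin
  suc (suc (2 * i)) / 2  ≡⟨ /-congˡ {o = 2} (cong (2 +_) (*-comm 2 i)) ⟩
  (2 + i * 2) / 2        ≡⟨ +-distrib-/-∣ʳ 2 {d = 2} (divides-refl i) ⟩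
  suc (i * 2 / 2)        ≡⟨ cong suc (m*n/n≡m i 2) ⟩
  suc i                  ∎

double-pred : ∀ i → 2 * suc i ∸ 1 ≡ suc (2 * i)
double-pred i = cong (_∸ 1) (*-suc 2 i)

<-triple : ∀ m → suc m < 3 * suc m
<-triple m = m<m+n (suc m) z<s

residue : ∀ r r' a b → r + 3 * a ≡ r' + 3 * b → r % 3 ≡ r' % 3
residue r r' a b e = begin
  r % 3             ≡⟨ [m+kn]%n≡m%n r a 3 ⟨
  (r + a * 3) % 3   ≡⟨ cong (λ x → (r + x) % 3) (*-comm a 3) ⟩
  (r + 3 * a) % 3   ≡⟨ cong (_% 3) e ⟩
  (r' + 3 * b) % 3  ≡⟨ cong (λ x → (r' + x) % 3) (*-comm 3 b) ⟩
  (r' + b * 3) % 3  ≡⟨ [m+kn]%n≡m%n r' b 3 ⟩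
  r' % 3            ∎

≡ᵇ-refl : ∀ n → (n ≡ᵇ n) ≡ true
≡ᵇ-refl n = Equivalence.to T-≡ (≡⇒≡ᵇ n n refl)

odd-midpoint : ∀ i → suc (2 * i) ∸ suc (2 * i) / 2 ≡ suc i
odd-midpoint i = begin
  suc (2 * i) ∸ suc (2 * i) / 2  ≡⟨ cong (suc (2 * i) ∸_) (half-odd i) ⟩
  suc (2 * i) ∸ i                ≡⟨ cong (_∸ i) (split i) ⟩
  suc i + i ∸ i                  ≡⟨ m+n∸n≡m (suc i) i ⟩
  suc i                          ∎
  where
  split : ∀ i → suc (2 * i) ≡ suc i + i
  split = solve-∀

odd-target : ∀ i → suc (2 * i) + suc (2 * i) / 2 ≡ suc (3 * i)
odd-target i = trans (cong (suc (2 * i) +_) (half-odd i)) (add i)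
  where
  add : ∀ i → suc (2 * i) + i ≡ suc (3 * i)
  add = solve-∀

even-midpoint : ∀ i → suc (suc (2 * i)) ∸ suc (suc (2 * i)) / 2 ≡ suc i
even-midpoint i = begin
  suc (suc (2 * i)) ∸ suc (suc (2 * i)) / 2  ≡⟨ cong (suc (suc (2 * i)) ∸_) (half-even i) ⟩
  suc (suc (2 * i)) ∸ suc i                  ≡⟨ cong (_∸ suc i) (split i) ⟩
  suc i + suc i ∸ suc i                      ≡⟨ m+n∸n≡m (suc i) (suc i) ⟩
  suc i                                      ∎
  where
  split : ∀ i → suc (suc (2 * i)) ≡ suc i + suc i
  split = solve-∀

even-target : ∀ i → suc (suc (2 * i)) + suc (suc (2 * i)) / 2 ≡ 3 * suc i
even-target i = trans (cong (suc (suc (2 * i)) +_) (half-even i)) (add i)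
  where
  add : ∀ i → suc (suc (2 * i)) + suc i ≡ 3 * suc i
  add = solve-∀

pos-odd : ∀ i → pos (suc (2 * i)) ≡ (if filled (2 * i) (suc i) then suc (3 * i) else suc i)
pos-odd i rewrite odd-midpoint i | odd-target i = refl

pos-free : ∀ i → filled (2 * i) (suc i) ≡ false → pos (suc (2 * i)) ≡ suc i
pos-free i f = trans (pos-odd i) (cong (λ b → if b then suc (3 * i) else suc i) f)

pos-taken : ∀ i → filled (2 * i) (suc i) ≡ true → pos (suc (2 * i)) ≡ suc (3 * i)
pos-taken i t = trans (pos-odd i) (cong (λ b → if b then suc (3 * i) else suc i) t)

-- After step 2i+1 the midpoint i+1 is taken: either it already was, or that
-- step took it.
midpoint-taken : ∀ i → filled (suc (2 * i)) (suc i) ≡ true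
midpoint-taken i with filled (2 * i) (suc i) in f
... | true  = refl
... | false = subst (λ p → (suc i ≡ᵇ p) ≡ true) (sym (pos-free i f)) (≡ᵇ-refl (suc i))

pos-even : ∀ i → pos (2 * suc i) ≡ 3 * suc i
pos-even i = begin
  pos (2 * suc i)                                                      ≡⟨ cong pos (*-suc 2 i) ⟩
  pos (suc (suc (2 * i)))                                              ≡⟨ pos-even-step ⟩
  (if filled (suc (2 * i)) (suc i) then 3 * suc i else suc i)
    ≡⟨ cong (λ b → if b then 3 * suc i else suc i) (midpoint-taken i) ⟩
  3 * suc i                                                            ∎
  where
  pos-even-step : pos (suc (suc (2 * i))) ≡
    (if filled (suc (2 * i)) (suc i) then 3 * suc i else suc i)
  pos-even-step rewrite even-midpoint i | even-target i = refl

filled-complete : ∀ {s m} → suc s ≤ m → filled m (pos (suc s)) ≡ true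
filled-complete {s} {suc m} le with m≤n⇒m<n∨m≡n le
... | inj₁ s<m  rewrite filled-complete (≤-pred s<m) = refl
... | inj₂ refl = trans (cong (filled m (pos (suc m)) ∨_) (≡ᵇ-refl (pos (suc m))))
                        (∨-zeroʳ (filled m (pos (suc m))))

filled-sound : ∀ {m p} → filled m p ≡ true → Σ ℕ λ s → suc s ≤ m × pos (suc s) ≡ p
filled-sound {suc m} {p} h with filled m p in e
... | true  = let (s , s≤m , w) = filled-sound e in s , m≤n⇒m≤1+n s≤m , w
... | false = m , ≤-refl , sym (≡ᵇ⇒≡ p (pos (suc m)) (Equivalence.from T-≡ h))

free-unwritten : ∀ {s m p} → filled m p ≡ false → pos (suc s) ≡ p → suc s ≤ m → ⊥
free-unwritten f refl le = contradiction (trans (sym f) (filled-complete le)) λ ()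

unwritten-free : ∀ {m p} → (∀ s → pos (suc s) ≡ p → m < suc s) → filled m p ≡ false
unwritten-free {m} {p} late with filled m p in e
... | false = refl
... | true with filled-sound e
...   | s , s≤m , w = ⊥-elim (<⇒≱ (late s w) s≤m)

data Action (s p : ℕ) : Set where
  even   : ∀ i → s ≡ 2 * suc i → p ≡ 3 * suc i → Action s p
  fresh  : ∀ i → s ≡ suc (2 * i) → p ≡ suc i → filled (2 * i) (suc i) ≡ false → Action s p
  bounce : ∀ i → s ≡ suc (2 * i) → p ≡ suc (3 * i) → filled (2 * i) (suc i) ≡ true → Action s p

odd-or-even : ∀ s → Σ ℕ λ i → suc s ≡ suc (2 * i) ⊎ suc s ≡ 2 * suc i
odd-or-even zero = 0 , inj₁ refl
odd-or-even (suc s) with odd-or-even s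
... | i , inj₁ refl = i , inj₂ (sym (*-suc 2 i))
... | i , inj₂ refl = suc i , inj₁ refl

action : ∀ s → Action (suc s) (pos (suc s))
action s with odd-or-even s
... | i , inj₂ refl = even i refl (pos-even i)
... | i , inj₁ refl with filled (2 * i) (suc i) in f
...   | true  = bounce i refl (pos-taken i f) f
...   | false = fresh i refl (pos-free i f) f

action-of : ∀ {s p} → pos (suc s) ≡ p → Action (suc s) p
action-of {s} refl = action s

action-pos : ∀ {s p} → Action s p → pos s ≡ p
action-pos (even i refl refl)     = pos-even i
action-pos (fresh i refl refl f)  = pos-free i f
action-pos (bounce i refl refl t) = pos-taken i t

-- A step s writes a position p with s ≤ 2p, so Π(p) looks far enough.
action-bound : ∀ {s p} → Action s p → s ≤ 2 * p
action-bound (even i refl refl)     = *-monoʳ-≤ 2 (m≤m+n (suc i) _)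
action-bound (fresh i refl refl _)  = *-monoʳ-< 2 (n<1+n i)
action-bound (bounce i refl refl _) = *-monoʳ-< 2 (s≤s (m≤m+n i _))

-- The midpoint written freshly by step 2i+1 has no other writer: an even step
-- or a bounce writing i+1 would come earlier, contradicting freshness.
fresh-unique : ∀ {i t} → filled (2 * i) (suc i) ≡ false → Action t (suc i) → t ≡ suc (2 * i)
fresh-unique f (fresh j refl e _) = cong (λ x → suc (2 * x)) (suc-injective (sym e))
fresh-unique f w@(even j refl refl) =
  ⊥-elim (free-unwritten f (action-pos w) (*-monoʳ-≤ 2 (≤-pred (<-triple j))))
fresh-unique f (bounce zero refl refl ())
fresh-unique f w@(bounce (suc j) refl refl _) =
  ⊥-elim (free-unwritten f (action-pos w) (*-monoʳ-< 2 (<-triple j)))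

-- Even steps and bounces write distinct residues modulo 3, and each of
-- them determines its step.
action-injective : ∀ {s t p} → Action s p → Action t p → s ≡ t
action-injective (fresh i refl refl f) w = sym (fresh-unique f w)
action-injective w (fresh i refl refl f) = fresh-unique f w
action-injective (even i refl refl) (even j refl e) =
  cong (2 *_) (*-cancelˡ-≡ (suc i) (suc j) 3 e)
action-injective (even i refl refl) (bounce j refl e _) =
  contradiction (residue 0 1 (suc i) j e) λ ()
action-injective (bounce i refl refl _) (even j refl e) =
  contradiction (residue 1 0 i (suc j) e) λ ()
action-injective (bounce i refl refl _) (bounce j refl e _) =
  cong (λ x → suc (2 * x)) (*-cancelˡ-≡ i j 3 (suc-injective e))

pos-injective : ∀ {s t} → pos (suc s) ≡ pos (suc t) → s ≡ t
pos-injective {s} e = suc-injective (action-injective (action s) (action-of (sym e)))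

-- lastStep finds any writer of n within its horizon, since writers are unique.
lastStep-writer : ∀ {s n} M → pos (suc s) ≡ n → suc s ≤ M → lastStep n M ≡ suc s
lastStep-writer {s} {n} (suc M) w le with pos (suc M) ≡ᵇ n in e
... | true  = cong suc (pos-injective (trans (≡ᵇ⇒≡ _ _ (Equivalence.from T-≡ e)) (sym w)))
... | false with m≤n⇒m<n∨m≡n le
...   | inj₁ s<M  = lastStep-writer M w (≤-pred s<M)
...   | inj₂ refl = ⊥-elim (subst T e (≡⇒≡ᵇ _ _ w))

lastStep-writes : ∀ {n} M → 0 < lastStep n M → pos (lastStep n M) ≡ n
lastStep-writes {n} (suc M) nonzero with pos (suc M) ≡ᵇ n in e
... | true  = ≡ᵇ⇒≡ _ _ (Equivalence.from T-≡ e)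
... | false = lastStep-writes M nonzero

Π-writer : ∀ {s n} → pos (suc s) ≡ n → Π n ≡ suc s
Π-writer {s} {n} w =
  lastStep-writer (2 * n) w (subst (λ p → suc s ≤ 2 * p) w (action-bound (action s)))

Π-writes : ∀ {n} → 0 < Π n → pos (Π n) ≡ n
Π-writes {n} = lastStep-writes (2 * n)

-- Position 3i+2 can only be written freshly, by step 6i+3.
writer-3i+2 : ∀ {i s} → Action s (suc (suc (3 * i))) → 2 * suc (3 * i) < s
writer-3i+2 {i} (even j refl e)     = contradiction (residue 2 0 i (suc j) e) λ ()
writer-3i+2 (fresh j refl refl _)   = n<1+n _
writer-3i+2 {i} (bounce j refl e _) = contradiction (residue 2 1 i j e) λ ()

-- If the midpoint i+1 is free at step 2i+1, there is no bounce to 3i+1, so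
-- position 3i+1 can only be written freshly, by step 6i+1.
writer-3i+1 : ∀ {i s} → filled (2 * i) (suc i) ≡ false → Action s (suc (3 * i)) → 2 * (3 * i) < s
writer-3i+1 {i} f (even j refl e)   = contradiction (residue 1 0 i (suc j) e) λ ()
writer-3i+1 f (fresh j refl refl _) = n<1+n _
writer-3i+1 {i} f (bounce j refl e t) with *-cancelˡ-≡ i j 3 (suc-injective e)
... | refl = contradiction (trans (sym f) t) λ ()

Π-free-midpoint : ∀ i → filled (2 * i) (suc i) ≡ false → Π (suc i) ≡ suc (2 * i)
Π-free-midpoint i f = Π-writer (pos-free i f)

Π-taken-midpoint : ∀ i → filled (2 * i) (suc i) ≡ true → Π (suc i) ≤ 2 * i
Π-taken-midpoint i t with filled-sound {2 * i} t
... | s , s≤2i , w = subst (_≤ 2 * i) (sym (Π-writer w)) s≤2i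

Π-bounce : ∀ i → filled (2 * i) (suc i) ≡ true → Π (suc (3 * i)) ≡ suc (2 * i)
Π-bounce i t = Π-writer (pos-taken i t)

Π-3k : ∀ i → Π (3 * suc i) ≡ 2 * suc i
Π-3k i = Π-writer (pos-even i)

Π-3k+2 : ∀ i → Π (suc (suc (3 * i))) ≡ suc (2 * suc (3 * i))
Π-3k+2 i = Π-free-midpoint (suc (3 * i)) (unwritten-free λ s w → writer-3i+2 {i} (action-of w))

Π-3k+1 : ∀ i → filled (2 * i) (suc i) ≡ false → Π (suc (3 * i)) ≡ suc (2 * (3 * i))
Π-3k+1 i f = Π-free-midpoint (3 * i) (unwritten-free λ s w → writer-3i+1 {i} f (action-of w))

typeI-of : ∀ i → 1 ≤ i → Π (suc i) ≡ suc (2 * i) → TypeI (suc i)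
typeI-of (suc i) _ eq =
  subst (suc (suc i) <_) (sym eq) (s≤s (m<m+n (suc i) z<s)) , trans eq (sym (double-pred (suc i)))

-- (a) Step 2n writes 3n ≠ n, so Π(n) ≠ 2n.
not-typeII : ∀ n → 1 ≤ n → ¬ TypeII n
not-typeII (suc n) _ (n<Π , Π≡2n) = <-irrefl (sym triple≡) (<-triple n)
  where
  triple≡ : 3 * suc n ≡ suc n
  triple≡ = begin
    3 * suc n        ≡⟨ pos-even n ⟨
    pos (2 * suc n)  ≡⟨ cong pos Π≡2n ⟨
    pos (Π (suc n))  ≡⟨ Π-writes (≤-trans (s≤s z≤n) n<Π) ⟩
    suc n            ∎

typeIV-3k : ∀ k → 1 ≤ k → TypeIV (3 * k)
typeIV-3k (suc k) _ =
  subst (λ v → (v < 3 * suc k) × (3 * v ≡ 2 * (3 * suc k))) (sym (Π-3k k))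
    (m<n+m (2 * suc k) z<s , trans (sym (*-assoc 3 2 (suc k))) (*-assoc 2 3 (suc k)))

typeI-3k+2 : ∀ k → TypeI (3 * k + 2)
typeI-3k+2 k = subst TypeI (sym (+-comm (3 * k) 2)) (typeI-of (suc (3 * k)) (s≤s z≤n) (Π-3k+2 k))

-- (d) Π(3k+1) is of type I exactly when the midpoint k+1 is free at step
-- 2k+1, which is when Π(k+1) = 2k+1; otherwise it is of type III.
typeI-3k+1 : ∀ k → 1 ≤ k → TypeI (k + 1) → TypeI (3 * k + 1)
typeI-3k+1 k 1≤k typeI =
  subst TypeI (sym (+-comm (3 * k) 1)) (by-midpoint (subst TypeI (+-comm k 1) typeI))
  where
  by-midpoint : TypeI (suc k) → TypeI (suc (3 * k))
  by-midpoint (_ , Π≡2k+1) with filled (2 * k) (suc k) in f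
  ... | true  = ⊥-elim (1+n≰n (subst (_≤ 2 * k) (trans Π≡2k+1 (double-pred k)) (Π-taken-midpoint k f)))
  ... | false = typeI-of (3 * k) (≤-trans 1≤k (m≤m+n k _)) (Π-3k+1 k f)

typeIII-3k+1 : ∀ k → 1 ≤ k → TypeIII (k + 1) ⊎ TypeIV (k + 1) → TypeIII (3 * k + 1)
typeIII-3k+1 k 1≤k h =
  subst TypeIII (sym (+-comm (3 * k) 1)) (by-midpoint below)
  where
  below : Π (suc k) < suc k
  below = subst (λ x → Π x < x) (+-comm k 1) ([ proj₁ , proj₁ ]′ h)

  value : ∀ k → 3 * suc (2 * k) ≡ 2 * suc (3 * k) + 1
  value = solve-∀

  by-midpoint : Π (suc k) < suc k → TypeIII (suc (3 * k))
  by-midpoint Π<k+1 with filled (2 * k) (suc k) in f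
  ... | true  =
    subst (λ v → (v < suc (3 * k)) × (3 * v ≡ 2 * suc (3 * k) + 1)) (sym (Π-bounce k f))
      (s≤s (m<n+m (2 * k) 1≤k) , value k)
  ... | false =
    ⊥-elim (<⇒≱ Π<k+1 (subst (suc k ≤_) (sym (Π-free-midpoint k f)) (s≤s (m≤m+n k _))))

theorem1 : (n k : ℕ) → 1 ≤ n → 1 ≤ k →
    ¬ TypeII n
    × (n ≡ 3 * k → TypeIV n)
    × (n ≡ 3 * k + 2 → TypeI n)
    × (n ≡ 3 * k + 1 → (TypeI (k + 1) → TypeI n) × (TypeIII (k + 1) ⊎ TypeIV (k + 1) → TypeIII n))
theorem1 n k 1≤n 1≤k =
    not-typeII n 1≤n
  , (λ { refl → typeIV-3k k 1≤k })
  , (λ { refl → typeI-3k+2 k })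
  , (λ { refl → typeI-3k+1 k 1≤k , typeIII-3k+1 k 1≤k })
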